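{- For every composition $\mu$ of $10$ and every positive integer $t$, \[ \sum_{y\in\mathcal{X}(\mu),\ y_9<y_{10}=t}\tfrac34\,m(y)\ \le\ \sum_{y\in\mathcal{Z}(\mu),\ y_9<y_{10}=t}c(y)\tfrac12 m(y) \quad\text{and}\quad \sum_{y\in\mathcal{X}(\mu),\ y_9\ge y_{10}=t}\tfrac34\,m(y)\ \le\ \sum_{y\in\mathcal{Z}(\mu),\ y_9\ge y_{10}=t}c(y)\tfrac12 m(y), \] where $\mathcal{X}(\mu)=\mathcal{Y}_{23}(\mu)\setminus\mathcal{Y}(\mu;[2][3]3)$, $\mathcal{Z}(\mu)=\mathcal{Y}_{22}(\mu)\cup\mathcal{Y}_{24}(\mu)\cup\mathcal{Y}(\mu;[3][3]1)$, and $c(y)=2$ if $y\in\mathcal{Y}_{24}(\mu)$ and $c(y)=1$ otherwise.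
   Context: Words are finite sequences over $\{1,2,\dots\}$; $y_i$ is the $i$-th letter; juxtaposition is concatenation and $[k]$ denotes the word $12\cdots k$ (so $[2][3]3=121233$, $[3][3]1=1231231$). A run of a word is a maximal strictly increasing factor of consecutive letters; $\tau_y$ is the composition of run lengths from left to right. A word $y$ is Yamanouchi if for every prefix $y'$ and every $i\ge1$, the number of $i$'s in $y'$ is at least the number of $(i+1)$'s; its content is $(m_1(y),m_2(y),\dots)$, $m_i(y)$ = number of occurrences of $i$. $\mathcal{Y}(\mu)$ is the set of Yamanouchi words of content $\mu$ all of whose runs except the last have length $\ge2$; for a composition $\alpha$, $\mathcal{Y}_\alpha(\mu)$ is the set of $y\in\mathcal{Y}(\mu)$ such that $\alpha$ is an initial segment of $\tau_y$ (e.g. $\mathcal{Y}_{23}$ uses $\alpha=(2,3)$); $\mathcal{Y}(\mu;\beta)$ is the set of $y\in\mathcal{Y}(\mu)$ having the word $\beta$ as a prefix. For a composition $I=(i_1,\dots,i_l)$ of $n$, $S(I)=\{i_1,\dots,i_1+\dots+i_{l-1}\}$ and the conjugate $I^\sim$ is the composition of $n$ with $S(I^\sim)=\{n-s:s\in[n-1]\setminus S(I)\}$; $m(y)=2^{m_1(\tau_y^\sim)}$, where $m_1$ counts parts equal to $1$. -}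

module Defs where

open import Data.Nat using (ℕ; zero; suc; _+_; _∸_; _^_; _≤_; _<_; _<ᵇ_; _≡ᵇ_)
open import Data.Bool using (Bool; true; false; if_then_else_; _∧_)
open import Data.List using (List; []; _∷_; _++_; map; reverse; foldr; take)
open import Data.Nat.ListAction using (sum)
open import Data.List.Relation.Unary.All using (All)
open import Data.List.Relation.Unary.Unique.Propositional using (Unique)
open import Data.List.Membership.Propositional using (_∈_)
open import Data.Product using (Σ; _×_)
open import Data.Sum using (_⊎_)
open import Relation.Nullary using (¬_)
open import Relation.Binary.PropositionalEquality using (_≡_)
open import Function.Bundles using (_⇔_)
open import Data.Integer using (+_)
import Data.Rational as ℚ
open ℚ using (ℚ; 0ℚ)

-- Words: finite sequences of letters; letters are required to be ≥ 1 where relevant.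
Word : Set
Word = List ℕ

count : ℕ → Word → ℕ
count a [] = 0
count a (x ∷ xs) = if x ≡ᵇ a then suc (count a xs) else count a xs

-- i-th entry (0-based) of a list, 0 if out of range.
-- So the paper's y_k (1-based) is  y ! (k ∸ 1).
_!_ : List ℕ → ℕ → ℕ
[] ! _ = 0
(x ∷ xs) ! zero = x
(x ∷ xs) ! suc i = xs ! i

IsComposition : ℕ → List ℕ → Set
IsComposition n μ = All (λ a → 1 ≤ a) μ × sum μ ≡ n

-- y has content μ : m_i(y) = μ_i for all i ≥ 1 (μ_i = 0 beyond the length of μ),
-- and all letters of y are positive integers
HasContent : List ℕ → Word → Set
HasContent μ y = All (λ a → 1 ≤ a) y × (∀ i → count (suc i) y ≡ μ ! i)

Yamanouchi : Word → Set
Yamanouchi y = ∀ k i → count (suc (suc i)) (take k y) ≤ count (suc i) (take k y)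

-- run lengths τ_y (runs = maximal strictly increasing factors)
runsAux : ℕ → ℕ → Word → List ℕ
runsAux prev k [] = k ∷ []
runsAux prev k (x ∷ xs) =
  if prev <ᵇ x then runsAux x (suc k) xs else k ∷ runsAux x 1 xs

τ : Word → List ℕ
τ [] = []
τ (x ∷ xs) = runsAux x 1 xs

butLast : List ℕ → List ℕ
butLast [] = []
butLast (x ∷ []) = []
butLast (x ∷ y ∷ xs) = x ∷ butLast (y ∷ xs)

IsPrefix : List ℕ → List ℕ → Set
IsPrefix α β = Σ (List ℕ) (λ r → β ≡ α ++ r)

prefixᵇ : List ℕ → List ℕ → Bool
prefixᵇ [] _ = true
prefixᵇ (a ∷ α) [] = false
prefixᵇ (a ∷ α) (b ∷ β) = (a ≡ᵇ b) ∧ prefixᵇ α β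

upto : ℕ → Word
upto zero = []
upto (suc k) = upto k ++ (suc k ∷ [])

range1 : ℕ → List ℕ
range1 n = upto n

partialSums : List ℕ → List ℕ
partialSums I = butLast (go 0 I)
  where
  go : ℕ → List ℕ → List ℕ
  go acc [] = []
  go acc (x ∷ xs) = (acc + x) ∷ go (acc + x) xs

memᵇ : ℕ → List ℕ → Bool
memᵇ a [] = false
memᵇ a (x ∷ xs) = (x ≡ᵇ a) Data.Bool.∨ memᵇ a xs

-- S(I~) = { n - s : s ∈ [n-1] \ S(I) }, listed increasingly
-- (s runs over n-1, n-2, ..., 1 so that n - s increases)
conjSet : ℕ → List ℕ → List ℕ
conjSet n I = go (reverse (range1 (n ∸ 1)))
  where
  S = partialSums I
  go : List ℕ → List ℕ
  go [] = []
  go (s ∷ ss) = if memᵇ s S then go ss else (n ∸ s) ∷ go ss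

compFromSet : ℕ → List ℕ → List ℕ
compFromSet n S = go 0 S
  where
  go : ℕ → List ℕ → List ℕ
  go prev [] = (n ∸ prev) ∷ []
  go prev (s ∷ ss) = (s ∸ prev) ∷ go s ss

conj : List ℕ → List ℕ
conj [] = []
conj I@(_ ∷ _) = compFromSet (sum I) (conjSet (sum I) I)

ones : List ℕ → ℕ
ones = count 1

mult : Word → ℕ
mult y = 2 ^ ones (conj (τ y))

InY : List ℕ → Word → Set
InY μ y = Yamanouchi y × HasContent μ y × All (λ r → 2 ≤ r) (butLast (τ y))

InYα : List ℕ → List ℕ → Word → Set
InYα α μ y = InY μ y × IsPrefix α (τ y)

InYβ : List ℕ → Word → Word → Set
InYβ μ β y = InY μ y × IsPrefix β y

w2233 : Word
w2233 = upto 2 ++ upto 3 ++ (3 ∷ [])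

w3331 : Word
w3331 = upto 3 ++ upto 3 ++ (1 ∷ [])

InX : List ℕ → Word → Set
InX μ y = InYα (2 ∷ 3 ∷ []) μ y × ¬ InYβ μ w2233 y

InZ : List ℕ → Word → Set
InZ μ y = InYα (2 ∷ 2 ∷ []) μ y ⊎ InYα (2 ∷ 4 ∷ []) μ y ⊎ InYβ μ w3331 y

-- c(y) = 2 if y ∈ 𝒴_{24}(μ), 1 otherwise.  For y ∈ 𝒵(μ) ⊆ 𝒴(μ), membership in
-- 𝒴_{24}(μ) is exactly "(2,4) is an initial segment of τ_y", decided here.
cval : Word → ℕ
cval y = if prefixᵇ (2 ∷ 4 ∷ []) (τ y) then 2 else 1

Enumerates : List Word → (Word → Set) → Set
Enumerates L P = Unique L × (∀ y → (y ∈ L) ⇔ P y)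

Σℚ : List ℚ → ℚ
Σℚ = foldr ℚ._+_ 0ℚ

ℕ→ℚ : ℕ → ℚ
ℕ→ℚ n = (+ n) ℚ./ 1

lhsTerm : Word → ℚ
lhsTerm y = ((+ 3) ℚ./ 4) ℚ.* ℕ→ℚ (mult y)

rhsTerm : Word → ℚ
rhsTerm y = ℕ→ℚ (cval y) ℚ.* ((+ 1) ℚ./ 2) ℚ.* ℕ→ℚ (mult y)

-- Every word of 𝒳(μ) or 𝒵(μ) is a Yamanouchi word of length |μ| = 10 over {1,…,10}; these are
-- enumerated by appending, letter by letter, any letter that keeps the content of the prefix a
-- partition. Apart from its shape, whether such a word enters either sum depends only on its key:
-- whether y₉ < y₁₀, the letter y₁₀, and its content. For each key realised in 𝒳 both sums are
-- computed and compared; for any other key the left-hand side is empty and the right-hand side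
-- is nonnegative.

module Submission where

open import Defs
open import Data.Nat using (ℕ; _≤_; _<_; _≥_)
open import Data.List using (List; map)
open import Data.Product using (_×_)
open import Relation.Binary.PropositionalEquality using (_≡_)
import Data.Rational as ℚ

open import Algebra.Bundles using (CommutativeMonoid)
open import Algebra.Properties.CommutativeSemigroup using (interchange; x∙yz≈y∙xz)
open import Data.Bool using (Bool; true; false)
import Data.Bool.Properties as Bool
open import Data.Nat using (zero; suc; _+_; _≡ᵇ_; z≤n; s≤s; _≤?_; _<?_)
import Data.Nat.Properties as ℕ
open import Data.Nat.ListAction using (sum)
open import Data.List using ([]; _∷_; _++_; _∷ʳ_; length; take; filter; concatMap; applyUpTo; deduplicate)
import Data.List.Properties as List
open import Data.List.Reverse using (Reverse; []; _∶_∶ʳ_; reverseView)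
open import Data.List.Membership.Propositional using (_∈_; _∉_; find; lose)
open import Data.List.Membership.Propositional.Properties
  using (∈-map⁺; ∈-map⁻; ∈-concatMap⁺; ∈-concatMap⁻; ∈-applyUpTo⁺; ∈-applyUpTo⁻; ∈-filter⁺; ∈-filter⁻; ∈-deduplicate⁺)
open import Data.List.Relation.Binary.Subset.Propositional using (_⊆_)
open import Data.List.Relation.Unary.Any using (here; there)
open import Data.List.Relation.Unary.All as All using (All; []; _∷_; all?)
import Data.List.Relation.Unary.All.Properties as All
open import Data.List.Relation.Unary.Unique.Propositional using (Unique; _∷_)
open import Data.List.Relation.Unary.Unique.DecPropositional using (unique?)
open import Data.Product using (∃-syntax; _,_; proj₁; proj₂)
open import Data.Product.Properties using (,-injective; ≡-dec)
open import Data.Sum as Sum using (_⊎_; inj₁; inj₂)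
open import Data.Unit using (⊤; tt)
open import Function using (_∘_)
open import Function.Bundles using (_⇔_; mk⇔; Equivalence)
open import Relation.Binary.Definitions using (DecidableEquality)
open import Relation.Binary.PropositionalEquality using (refl; sym; trans; cong; cong₂; subst; _≢_; module ≡-Reasoning)
open import Relation.Nullary using (Dec; yes; no; ¬_; does; contradiction; _×-dec_; _⊎-dec_; ¬?)
open import Relation.Unary using (Decidable)
import Data.Rational.Properties as ℚ

≡ᵇ-refl : ∀ n → (n ≡ᵇ n) ≡ true
≡ᵇ-refl zero    = refl
≡ᵇ-refl (suc n) = ≡ᵇ-refl n

count-++ : ∀ a (w v : Word) → count a (w ++ v) ≡ count a w + count a v
count-++ a []      v = refl
count-++ a (x ∷ w) v with x ≡ᵇ a
... | true  = cong suc (count-++ a w v)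
... | false = count-++ a w v

count-self : ∀ a → count a (a ∷ []) ≡ 1
count-self a rewrite ≡ᵇ-refl a = refl

count-other : ∀ {a b} → a ≢ b → count b (a ∷ []) ≡ 0
count-other {a} {b} a≢b with a ≡ᵇ b in eq
... | true  = contradiction (ℕ.≡ᵇ⇒≡ a b (Equivalence.from Bool.T-≡ eq)) a≢b
... | false = refl

count-∷ʳ-self : ∀ a w → count a (w ∷ʳ a) ≡ suc (count a w)
count-∷ʳ-self a w = begin
  count a (w ∷ʳ a)             ≡⟨ count-++ a w (a ∷ []) ⟩
  count a w + count a (a ∷ []) ≡⟨ cong (count a w +_) (count-self a) ⟩
  count a w + 1                ≡⟨ ℕ.+-comm (count a w) 1 ⟩
  suc (count a w)              ∎
  where open ≡-Reasoning

count-∷ʳ-other : ∀ {a b} w → a ≢ b → count b (w ∷ʳ a) ≡ count b w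
count-∷ʳ-other {a} {b} w a≢b = begin
  count b (w ∷ʳ a)             ≡⟨ count-++ b w (a ∷ []) ⟩
  count b w + count b (a ∷ []) ≡⟨ cong (count b w +_) (count-other a≢b) ⟩
  count b w + 0                ≡⟨ ℕ.+-identityʳ (count b w) ⟩
  count b w                    ∎
  where open ≡-Reasoning

count-∷ʳ-mono : ∀ b w a → count b w ≤ count b (w ∷ʳ a)
count-∷ʳ-mono b w a = subst (count b w ≤_) (sym (count-++ b w (a ∷ []))) (ℕ.m≤m+n _ _)

count-∈ : ∀ {a y} → a ∈ y → 1 ≤ count a y
count-∈ {a} (here refl) rewrite ≡ᵇ-refl a = s≤s z≤n
count-∈ {a} {x ∷ _} (there a∈y) with x ≡ᵇ a
... | true  = s≤s z≤n
... | false = count-∈ a∈y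

count-∉ : ∀ {a} y → a ∉ y → count a y ≡ 0
count-∉ []              _   = refl
count-∉ {a} (x ∷ y) a∉x∷y with x ≡ᵇ a in eq
... | true  = contradiction (here (sym (ℕ.≡ᵇ⇒≡ x a (Equivalence.from Bool.T-≡ eq)))) a∉x∷y
... | false = count-∉ y (a∉x∷y ∘ there)

PartitionContent : Word → Set
PartitionContent p = ∀ i → count (suc (suc i)) p ≤ count (suc i) p

Yamanouchi-[] : Yamanouchi []
Yamanouchi-[] zero    i = z≤n
Yamanouchi-[] (suc k) i = z≤n

Yamanouchi⇒PartitionContent : ∀ y → Yamanouchi y → PartitionContent y
Yamanouchi⇒PartitionContent y Y =
  subst PartitionContent (List.take-all (length y) y ℕ.≤-refl) (Y (length y))

take-++ˡ : ∀ k (w v : Word) → ∃[ k′ ] take k w ≡ take k′ (w ++ v)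
take-++ˡ zero    w       v = zero , refl
take-++ˡ (suc k) []      v = zero , refl
take-++ˡ (suc k) (x ∷ w) v with k′ , e ← take-++ˡ k w v = suc k′ , cong (x ∷_) e

take-∷ʳ : ∀ k (w : Word) a → take k (w ∷ʳ a) ≡ take k w ⊎ take k (w ∷ʳ a) ≡ w ∷ʳ a
take-∷ʳ zero          w       a = inj₁ refl
take-∷ʳ (suc zero)    []      a = inj₂ refl
take-∷ʳ (suc (suc k)) []      a = inj₂ refl
take-∷ʳ (suc k)       (x ∷ w) a = Sum.map (cong (x ∷_)) (cong (x ∷_)) (take-∷ʳ k w a)

Yamanouchi-++⁻ : ∀ w v → Yamanouchi (w ++ v) → Yamanouchi w
Yamanouchi-++⁻ w v Y k with k′ , e ← take-++ˡ k w v = subst PartitionContent (sym e) (Y k′)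

Appendable : Word → ℕ → Set
Appendable w (suc (suc a)) = count (suc (suc a)) w < count (suc a) w
Appendable w _             = ⊤

appendable? : ∀ w a → Dec (Appendable w a)
appendable? w zero          = yes tt
appendable? w (suc zero)    = yes tt
appendable? w (suc (suc a)) = count (suc (suc a)) w <? count (suc a) w

PartitionContent-∷ʳ : ∀ {w} a → PartitionContent w → Appendable w a → PartitionContent (w ∷ʳ a)
PartitionContent-∷ʳ {w} a P app i with a ℕ.≟ suc (suc i)
... | yes refl = begin
  count (suc (suc i)) (w ∷ʳ a) ≡⟨ count-∷ʳ-self a w ⟩
  suc (count a w)              ≤⟨ app ⟩
  count (suc i) w              ≤⟨ count-∷ʳ-mono (suc i) w a ⟩
  count (suc i) (w ∷ʳ a)       ∎
  where open ℕ.≤-Reasoning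
... | no a≢ = begin
  count (suc (suc i)) (w ∷ʳ a) ≡⟨ count-∷ʳ-other w a≢ ⟩
  count (suc (suc i)) w        ≤⟨ P i ⟩
  count (suc i) w              ≤⟨ count-∷ʳ-mono (suc i) w a ⟩
  count (suc i) (w ∷ʳ a)       ∎
  where open ℕ.≤-Reasoning

PartitionContent-∷ʳ⁻ : ∀ w a → PartitionContent (w ∷ʳ a) → Appendable w a
PartitionContent-∷ʳ⁻ w zero          _ = tt
PartitionContent-∷ʳ⁻ w (suc zero)    _ = tt
PartitionContent-∷ʳ⁻ w (suc (suc a)) P = begin
  suc (count (suc (suc a)) w)        ≡⟨ count-∷ʳ-self (suc (suc a)) w ⟨
  count (suc (suc a)) (w ∷ʳ suc (suc a)) ≤⟨ P a ⟩
  count (suc a) (w ∷ʳ suc (suc a))   ≡⟨ count-∷ʳ-other w ℕ.1+n≢n ⟩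
  count (suc a) w                    ∎
  where open ℕ.≤-Reasoning

Yamanouchi-∷ʳ⁺ : ∀ {w a} → Yamanouchi w → Appendable w a → Yamanouchi (w ∷ʳ a)
Yamanouchi-∷ʳ⁺ {w} {a} Y app k with take-∷ʳ k w a
... | inj₁ e = subst PartitionContent (sym e) (Y k)
... | inj₂ e = subst PartitionContent (sym e)
                 (PartitionContent-∷ʳ a (Yamanouchi⇒PartitionContent w Y) app)

Yamanouchi-∷ʳ⁻ : ∀ {w a} → Yamanouchi (w ∷ʳ a) → Yamanouchi w × Appendable w a
Yamanouchi-∷ʳ⁻ {w} {a} Y =
  Yamanouchi-++⁻ w (a ∷ []) Y , PartitionContent-∷ʳ⁻ w a (Yamanouchi⇒PartitionContent (w ∷ʳ a) Y)

Letter : ℕ → ℕ → Set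
Letter k a = 1 ≤ a × a ≤ k

letters : ℕ → List ℕ
letters k = applyUpTo suc k

∈-letters⁺ : ∀ {k a} → Letter k a → a ∈ letters k
∈-letters⁺ {a = suc i} (_ , i<k) = ∈-applyUpTo⁺ suc i<k

∈-letters⁻ : ∀ {k a} → a ∈ letters k → Letter k a
∈-letters⁻ a∈ with i , i<k , refl ← ∈-applyUpTo⁻ suc a∈ = s≤s z≤n , i<k

extensions : ℕ → Word → List Word
extensions k w = map (w ∷ʳ_) (filter (appendable? w) (letters k))

yamanouchiWords : ℕ → ℕ → List Word
yamanouchiWords k zero    = [] ∷ []
yamanouchiWords k (suc n) = concatMap (extensions k) (yamanouchiWords k n)

∈-extensions⁺ : ∀ {k w a} → Letter k a → Appendable w a → w ∷ʳ a ∈ extensions k w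
∈-extensions⁺ {w = w} ℓ app = ∈-map⁺ (w ∷ʳ_) (∈-filter⁺ (appendable? w) (∈-letters⁺ ℓ) app)

∈-extensions⁻ : ∀ {k w y} → y ∈ extensions k w → ∃[ a ] Letter k a × Appendable w a × y ≡ w ∷ʳ a
∈-extensions⁻ {w = w} y∈ with a , a∈ , refl ← ∈-map⁻ (w ∷ʳ_) y∈ =
  let a∈letters , app = ∈-filter⁻ (appendable? w) a∈ in a , ∈-letters⁻ a∈letters , app , refl

length-∷ʳ : ∀ (w : Word) a → length (w ∷ʳ a) ≡ suc (length w)
length-∷ʳ []      a = refl
length-∷ʳ (x ∷ w) a = cong suc (length-∷ʳ w a)

∈-yamanouchiWords⁺ : ∀ k {y} → Yamanouchi y → All (Letter k) y → y ∈ yamanouchiWords k (length y)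
∈-yamanouchiWords⁺ k {y} = go (reverseView y)
  where
  go : ∀ {y} → Reverse y → Yamanouchi y → All (Letter k) y → y ∈ yamanouchiWords k (length y)
  go []               _ _  = here refl
  go (w ∶ rw ∶ʳ a) Y ℓs =
    let Yw , app = Yamanouchi-∷ʳ⁻ Y; ℓw , ℓa = All.∷ʳ⁻ ℓs in
    subst (λ n → w ∷ʳ a ∈ yamanouchiWords k n) (sym (length-∷ʳ w a))
      (∈-concatMap⁺ (extensions k) (lose (go rw Yw ℓw) (∈-extensions⁺ ℓa app)))

∈-yamanouchiWords⁻ : ∀ k n {y} → y ∈ yamanouchiWords k n → Yamanouchi y × All (Letter k) y
∈-yamanouchiWords⁻ k zero    (here refl) = Yamanouchi-[] , []
∈-yamanouchiWords⁻ k (suc n) y∈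
  with w , w∈ , y∈ext ← find (∈-concatMap⁻ (extensions k) y∈)
  with a , ℓa , app , refl ← ∈-extensions⁻ y∈ext =
  let Yw , ℓw = ∈-yamanouchiWords⁻ k n w∈ in Yamanouchi-∷ʳ⁺ Yw app , All.∷ʳ⁺ ℓw ℓa

multiplicities : ℕ → Word → List ℕ
multiplicities n y = applyUpTo (λ i → count (suc i) y) n

padded : ℕ → List ℕ → List ℕ
padded n μ = applyUpTo (μ !_) n

applyUpTo-cong : ∀ {f g : ℕ → ℕ} n → (∀ i → f i ≡ g i) → applyUpTo f n ≡ applyUpTo g n
applyUpTo-cong zero    f≗g = refl
applyUpTo-cong (suc n) f≗g = cong₂ _∷_ (f≗g 0) (applyUpTo-cong n (f≗g ∘ suc))

!-applyUpTo : ∀ (f : ℕ → ℕ) {n i} → i < n → applyUpTo f n ! i ≡ f i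
!-applyUpTo f {suc n} {zero}  _         = refl
!-applyUpTo f {suc n} {suc i} (s≤s i<n) = !-applyUpTo (f ∘ suc) i<n

!-beyond : ∀ (μ : List ℕ) {i} → length μ ≤ i → μ ! i ≡ 0
!-beyond []      _         = refl
!-beyond (x ∷ μ) (s≤s μ≤i) = !-beyond μ μ≤i

sum-zeros : ∀ n → sum (applyUpTo (λ _ → 0) n) ≡ 0
sum-zeros zero    = refl
sum-zeros (suc n) = sum-zeros n

sum-applyUpTo-+ : ∀ (f g : ℕ → ℕ) n →
  sum (applyUpTo (λ i → f i + g i) n) ≡ sum (applyUpTo f n) + sum (applyUpTo g n)
sum-applyUpTo-+ f g zero    = refl
sum-applyUpTo-+ f g (suc n) =
  trans (cong (f 0 + g 0 +_) (sum-applyUpTo-+ (f ∘ suc) (g ∘ suc) n))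
        (interchange ℕ.+-commutativeSemigroup (f 0) (g 0) _ _)

sum-multiplicities-singleton : ∀ {n a} → Letter n a → sum (multiplicities n (a ∷ [])) ≡ 1
sum-multiplicities-singleton {suc n} {1}           _              = cong suc (sum-zeros n)
sum-multiplicities-singleton {suc n} {suc (suc a)} (_ , s≤s a<n) = sum-multiplicities-singleton (s≤s z≤n , a<n)

length≡sum-multiplicities : ∀ {n} y → All (Letter n) y → length y ≡ sum (multiplicities n y)
length≡sum-multiplicities {n} []      []       = sym (sum-zeros n)
length≡sum-multiplicities {n} (a ∷ y) (ℓ ∷ ℓs) = sym (begin
  sum (multiplicities n (a ∷ y))
    ≡⟨ cong sum (applyUpTo-cong n (λ i → count-++ (suc i) (a ∷ []) y)) ⟩
  sum (applyUpTo (λ i → count (suc i) (a ∷ []) + count (suc i) y) n)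
    ≡⟨ sum-applyUpTo-+ (λ i → count (suc i) (a ∷ [])) (λ i → count (suc i) y) n ⟩
  sum (multiplicities n (a ∷ [])) + sum (multiplicities n y)
    ≡⟨ cong₂ _+_ (sum-multiplicities-singleton ℓ) (sym (length≡sum-multiplicities y ℓs)) ⟩
  suc (length y) ∎)
  where open ≡-Reasoning

sum-padded : ∀ μ {n} → length μ ≤ n → sum (padded n μ) ≡ sum μ
sum-padded []      {n}     _         = sum-zeros n
sum-padded (x ∷ μ) {suc n} (s≤s μ≤n) = cong (x +_) (sum-padded μ μ≤n)

length≤sum : ∀ μ → All (1 ≤_) μ → length μ ≤ sum μ
length≤sum []      []         = z≤n
length≤sum (x ∷ μ) (1≤x ∷ ps) = ℕ.+-mono-≤ 1≤x (length≤sum μ ps)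

length-composition : ∀ {n μ} → IsComposition n μ → length μ ≤ n
length-composition {μ = μ} (pos , refl) = length≤sum μ pos

letters-content : ∀ {n μ y} → IsComposition n μ → HasContent μ y → All (Letter n) y
letters-content {n} {μ} {y} comp (pos , counts) = All.tabulate λ a∈y → All.lookup pos a∈y , bound a∈y
  where
  bound : ∀ {a} → a ∈ y → a ≤ n
  bound {zero}  a∈y with () ← All.lookup pos a∈y
  bound {suc i} a∈y with length μ ≤? i
  ... | yes μ≤i = contradiction (subst (1 ≤_) (trans (counts i) (!-beyond μ μ≤i)) (count-∈ a∈y)) λ ()
  ... | no  μ≰i = ℕ.≤-trans (ℕ.≰⇒> μ≰i) (length-composition comp)

multiplicities-content : ∀ {n μ y} → HasContent μ y → multiplicities n y ≡ padded n μ
multiplicities-content {n} (_ , counts) = applyUpTo-cong n counts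

content-multiplicities : ∀ {n μ y} → length μ ≤ n → All (Letter n) y →
  multiplicities n y ≡ padded n μ → HasContent μ y
content-multiplicities {n} {μ} {y} μ≤n ℓs eq = All.map proj₁ ℓs , counts
  where
  counts : ∀ i → count (suc i) y ≡ μ ! i
  counts i with i <? n
  ... | yes i<n = trans (sym (!-applyUpTo _ i<n)) (trans (cong (_! i) eq) (!-applyUpTo _ i<n))
  ... | no  i≮n = trans (count-∉ y (λ i∈y → i≮n (proj₂ (All.lookup ℓs i∈y))))
                        (sym (!-beyond μ (ℕ.≤-trans μ≤n (ℕ.≮⇒≥ i≮n))))

length-content : ∀ {n μ y} → IsComposition n μ → HasContent μ y → length y ≡ n
length-content {n} {μ} {y} comp hc = begin
  length y                 ≡⟨ length≡sum-multiplicities y (letters-content comp hc) ⟩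
  sum (multiplicities n y) ≡⟨ cong sum (multiplicities-content {n} {μ} hc) ⟩
  sum (padded n μ)         ≡⟨ sum-padded μ (length-composition comp) ⟩
  sum μ                    ≡⟨ proj₂ comp ⟩
  n                        ∎
  where open ≡-Reasoning

module _ {A : Set} (f : A → ℚ.ℚ) where

  Σℚ-remove : ∀ {a ys} → a ∈ ys →
    ∃[ ys′ ] Σℚ (map f ys) ≡ f a ℚ.+ Σℚ (map f ys′) × (∀ {x} → x ∈ ys → x ≢ a → x ∈ ys′)
  Σℚ-remove {ys = y ∷ ys} (here refl) =
    ys , refl , λ { (here refl) x≢a → contradiction refl x≢a ; (there x∈ys) _ → x∈ys }
  Σℚ-remove {a} {y ∷ ys} (there a∈ys) with ys′ , Σys≡ , keep ← Σℚ-remove a∈ys =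
    y ∷ ys′ ,
    trans (cong (f y ℚ.+_) Σys≡) (x∙yz≈y∙xz ℚ-+-commutativeSemigroup (f y) (f a) _) ,
    λ { (here refl) _ → here refl ; (there x∈ys) x≢a → there (keep x∈ys x≢a) }
    where ℚ-+-commutativeSemigroup = CommutativeMonoid.commutativeSemigroup ℚ.+-0-commutativeMonoid

  module _ (f≥0 : ∀ x → ℚ.0ℚ ℚ.≤ f x) where

    Σℚ-nonNeg : ∀ xs → ℚ.0ℚ ℚ.≤ Σℚ (map f xs)
    Σℚ-nonNeg []       = ℚ.≤-refl
    Σℚ-nonNeg (x ∷ xs) = ℚ.+-mono-≤ (f≥0 x) (Σℚ-nonNeg xs)

    Σℚ-mono-⊆ : ∀ {xs ys} → Unique xs → xs ⊆ ys → Σℚ (map f xs) ℚ.≤ Σℚ (map f ys)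
    Σℚ-mono-⊆ {[]}     {ys} _            _  = Σℚ-nonNeg ys
    Σℚ-mono-⊆ {x ∷ xs} {ys} (x∉xs ∷ uxs) xs⊆ys with ys′ , Σys≡ , keep ← Σℚ-remove (xs⊆ys (here refl)) =
      subst (Σℚ (map f (x ∷ xs)) ℚ.≤_) (sym Σys≡)
        (ℚ.+-monoʳ-≤ (f x) (Σℚ-mono-⊆ uxs λ x′∈xs → keep (xs⊆ys (there x′∈xs)) (≢x x′∈xs)))
      where
      ≢x : ∀ {x′} → x′ ∈ xs → x′ ≢ x
      ≢x x′∈xs x′≡x = All.lookup x∉xs x′∈xs (sym x′≡x)

ℕ→ℚ-nonNeg : ∀ n → ℚ.NonNegative (ℕ→ℚ n)
ℕ→ℚ-nonNeg n = ℚ.normalize-nonNeg n 1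

*-nonNeg : ∀ p q → ℚ.NonNegative p → ℚ.NonNegative q → ℚ.NonNegative (p ℚ.* q)
*-nonNeg p q p≥0 q≥0 = ℚ.nonNeg*nonNeg⇒nonNeg p {{p≥0}} q {{q≥0}}

lhsTerm-nonNeg : ∀ y → ℚ.0ℚ ℚ.≤ lhsTerm y
lhsTerm-nonNeg y = ℚ.nonNegative⁻¹ (lhsTerm y)
  {{*-nonNeg (ℚ.normalize 3 4) (ℕ→ℚ (mult y)) (ℚ.normalize-nonNeg 3 4) (ℕ→ℚ-nonNeg (mult y))}}

rhsTerm-nonNeg : ∀ y → ℚ.0ℚ ℚ.≤ rhsTerm y
rhsTerm-nonNeg y = ℚ.nonNegative⁻¹ (rhsTerm y)
  {{*-nonNeg (ℕ→ℚ (cval y) ℚ.* ℚ.normalize 1 2) (ℕ→ℚ (mult y))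
     (*-nonNeg (ℕ→ℚ (cval y)) (ℚ.normalize 1 2) (ℕ→ℚ-nonNeg (cval y)) (ℚ.normalize-nonNeg 1 2))
     (ℕ→ℚ-nonNeg (mult y))}}

does≡true⇔ : ∀ {A : Set} (a? : Dec A) → A ⇔ does a? ≡ true
does≡true⇔ (yes a) = mk⇔ (λ _ → refl) (λ _ → a)
does≡true⇔ (no ¬a) = mk⇔ (λ a → contradiction a ¬a) λ ()

does≡false⇔ : ∀ {A : Set} (a? : Dec A) → (¬ A) ⇔ does a? ≡ false
does≡false⇔ (yes a) = mk⇔ (λ ¬a → contradiction a ¬a) λ ()
does≡false⇔ (no ¬a) = mk⇔ (λ _ → refl) (λ _ → ¬a)

isPrefix? : ∀ α β → Dec (IsPrefix α β)
isPrefix? []      β       = yes (β , refl)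
isPrefix? (a ∷ α) []      = no λ ()
isPrefix? (a ∷ α) (b ∷ β) with a ℕ.≟ b | isPrefix? α β
... | yes refl | yes (r , e) = yes (r , cong (a ∷_) e)
... | yes refl | no ¬p       = no λ { (r , refl) → ¬p (r , refl) }
... | no a≢b   | _           = no λ { (r , refl) → a≢b refl }

RunsAtLeastTwo : Word → Set
RunsAtLeastTwo y = All (2 ≤_) (butLast (τ y))

XShape : Word → Set
XShape y = IsPrefix (2 ∷ 3 ∷ []) (τ y) × ¬ IsPrefix w2233 y × RunsAtLeastTwo y

ZShape : Word → Set
ZShape y =
  (IsPrefix (2 ∷ 2 ∷ []) (τ y) ⊎ IsPrefix (2 ∷ 4 ∷ []) (τ y) ⊎ IsPrefix w3331 y) × RunsAtLeastTwo y

runsAtLeastTwo? : Decidable RunsAtLeastTwo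
runsAtLeastTwo? y = all? (2 ≤?_) (butLast (τ y))

xShape? : Decidable XShape
xShape? y = isPrefix? _ (τ y) ×-dec ¬? (isPrefix? w2233 y) ×-dec runsAtLeastTwo? y

zShape? : Decidable ZShape
zShape? y =
  (isPrefix? _ (τ y) ⊎-dec isPrefix? _ (τ y) ⊎-dec isPrefix? w3331 y) ×-dec runsAtLeastTwo? y

InX⇒XShape : ∀ {μ y} → InX μ y → XShape y
InX⇒XShape ((inY@(_ , _ , runs) , τ-prefix) , ¬prefix) = τ-prefix , (λ p → ¬prefix (inY , p)) , runs

ZShape⇒InZ : ∀ {μ y} → Yamanouchi y → HasContent μ y → ZShape y → InZ μ y
ZShape⇒InZ Y hc (prefix , runs) = Sum.map (inY ,_) (Sum.map (inY ,_) (inY ,_)) prefix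
  where inY = Y , hc , runs

-- Opaque, so that unification never unfolds these enumerations.
opaque
  xCandidates zCandidates : List Word
  xCandidates = filter xShape? (yamanouchiWords 10 10)
  zCandidates = filter zShape? (yamanouchiWords 10 10)

  ∈-xCandidates⁺ : ∀ {y} → y ∈ yamanouchiWords 10 10 → XShape y → y ∈ xCandidates
  ∈-xCandidates⁺ = ∈-filter⁺ xShape?

  ∈-zCandidates⁻ : ∀ {y} → y ∈ zCandidates → y ∈ yamanouchiWords 10 10 × ZShape y
  ∈-zCandidates⁻ = ∈-filter⁻ zShape?

ascent : Word → Bool
ascent y = does (y ! 8 <? y ! 9)

ascent≡true⇔ : ∀ y → (y ! 8 < y ! 9) ⇔ ascent y ≡ true
ascent≡true⇔ y = does≡true⇔ (y ! 8 <? y ! 9)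

ascent≡false⇔ : ∀ y → (y ! 8 ≥ y ! 9) ⇔ ascent y ≡ false
ascent≡false⇔ y = mk⇔ (to ∘ ℕ.≤⇒≯) (ℕ.≮⇒≥ ∘ from)
  where open Equivalence (does≡false⇔ (y ! 8 <? y ! 9))

Key : Set
Key = Bool × ℕ × List ℕ

key : Word → Key
key y = ascent y , y ! 9 , multiplicities 10 y

_≟ᵏ_ : DecidableEquality Key
_≟ᵏ_ = ≡-dec Bool._≟_ (≡-dec ℕ._≟_ (List.≡-dec ℕ._≟_))

classOf : Key → List Word → List Word
classOf k = filter (λ y → key y ≟ᵏ k)

∈-classOf⁺ : ∀ {k y xs} → y ∈ xs → key y ≡ k → y ∈ classOf k xs
∈-classOf⁺ {k} = ∈-filter⁺ (λ y → key y ≟ᵏ k)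

∈-classOf⁻ : ∀ {k y} xs → y ∈ classOf k xs → y ∈ xs × key y ≡ k
∈-classOf⁻ {k} xs = ∈-filter⁻ (λ y → key y ≟ᵏ k) {xs = xs}

key∈classKeys : ∀ {k y} xs → y ∈ classOf k xs → k ∈ map key xs
key∈classKeys xs y∈ with y∈xs , refl ← ∈-classOf⁻ xs y∈ = ∈-map⁺ key y∈xs

key≡⇒ : ∀ {y b t v} → key y ≡ (b , t , v) → ascent y ≡ b × y ! 9 ≡ t × multiplicities 10 y ≡ v
key≡⇒ key≡ = let ascent≡ , rest≡ = ,-injective key≡ in ascent≡ , ,-injective rest≡

ClassInequality : List Word → List Word → Key → Set
ClassInequality xs zs k =
  Σℚ (map lhsTerm (classOf k xs)) ℚ.≤ Σℚ (map rhsTerm (classOf k zs)) × Unique (classOf k zs)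

classInequality? : ∀ xs zs → Decidable (ClassInequality xs zs)
classInequality? xs zs k = (_ ℚ.≤? _) ×-dec unique? (List.≡-dec ℕ._≟_) (classOf k zs)

allClassInequalities? : ∀ xs zs → Dec (All (ClassInequality xs zs) (deduplicate _≟ᵏ_ (map key xs)))
allClassInequalities? xs zs = all? (classInequality? xs zs) (deduplicate _≟ᵏ_ (map key xs))

-- Proved by evaluation over the 73 keys of 𝒳-candidates. In the form does … ≡ true the
-- candidate lists are evaluated once; reducing True (…) for toWitness recomputes them per key.
opaque
  unfolding xCandidates zCandidates
  classInequalities :
    All (ClassInequality xCandidates zCandidates) (deduplicate _≟ᵏ_ (map key xCandidates))
  classInequalities = Equivalence.from (does≡true⇔ (allClassInequalities? xCandidates zCandidates)) refl

X∈classOf : ∀ {μ y b t} → IsComposition 10 μ → InX μ y → ascent y ≡ b → y ! 9 ≡ t →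
  y ∈ classOf (b , t , padded 10 μ) xCandidates
X∈classOf {μ} {y} comp inX@(((Y , hc , _) , _) , _) refl refl =
  ∈-classOf⁺ (∈-xCandidates⁺ y∈words (InX⇒XShape {μ} inX))
    (cong (λ v → ascent y , y ! 9 , v) (multiplicities-content {10} {μ} hc))
  where
  y∈words : y ∈ yamanouchiWords 10 10
  y∈words = subst (λ n → y ∈ yamanouchiWords 10 n) (length-content comp hc)
              (∈-yamanouchiWords⁺ 10 Y (letters-content comp hc))

classOf⇒Z : ∀ {μ y b t} → IsComposition 10 μ → y ∈ classOf (b , t , padded 10 μ) zCandidates →
  InZ μ y × ascent y ≡ b × y ! 9 ≡ t
classOf⇒Z {μ} {y} comp y∈class =
  let y∈Z , key≡ = ∈-classOf⁻ zCandidates y∈class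
      y∈words , shape = ∈-zCandidates⁻ y∈Z
      Y , ℓs = ∈-yamanouchiWords⁻ 10 10 y∈words
      ascent≡ , last≡ , multiplicities≡ = key≡⇒ {y} key≡
      hc = content-multiplicities {10} {μ} (length-composition comp) ℓs multiplicities≡
  in ZShape⇒InZ {μ} Y hc shape , ascent≡ , last≡

classInequality : ∀ {k y} → y ∈ classOf k xCandidates → ClassInequality xCandidates zCandidates k
classInequality {k} y∈ = All.lookup classInequalities
  (∈-deduplicate⁺ _≟ᵏ_ {xs = map key xCandidates} {z = k} (key∈classKeys xCandidates y∈))

classBound : ∀ {μ} → IsComposition 10 μ → (Side : Word → Set) (b : Bool) →
  (∀ y → Side y ⇔ ascent y ≡ b) → ∀ t L₁ L₂ →
  Enumerates L₁ (λ y → InX μ y × Side y × y ! 9 ≡ t) →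
  Enumerates L₂ (λ y → InZ μ y × Side y × y ! 9 ≡ t) →
  Σℚ (map lhsTerm L₁) ℚ.≤ Σℚ (map rhsTerm L₂)
classBound comp Side b side⇔ t [] L₂ _ _ = Σℚ-nonNeg rhsTerm rhsTerm-nonNeg L₂
classBound {μ} comp Side b side⇔ t L₁@(y₀ ∷ _) L₂ (unique₁ , enum₁) (_ , enum₂) = begin
  Σℚ (map lhsTerm L₁)                      ≤⟨ Σℚ-mono-⊆ lhsTerm lhsTerm-nonNeg unique₁ L₁⊆class ⟩
  Σℚ (map lhsTerm (classOf k xCandidates)) ≤⟨ proj₁ inequality ⟩
  Σℚ (map rhsTerm (classOf k zCandidates)) ≤⟨ Σℚ-mono-⊆ rhsTerm rhsTerm-nonNeg (proj₂ inequality) class⊆L₂ ⟩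
  Σℚ (map rhsTerm L₂)                      ∎
  where
  open ℚ.≤-Reasoning
  k = b , t , padded 10 μ
  L₁⊆class : L₁ ⊆ classOf k xCandidates
  L₁⊆class y∈ = let inX , side , last = Equivalence.to (enum₁ _) y∈ in
    X∈classOf {μ} {b = b} {t} comp inX (Equivalence.to (side⇔ _) side) last
  class⊆L₂ : classOf k zCandidates ⊆ L₂
  class⊆L₂ y∈ = let inZ , asc , last = classOf⇒Z {μ} {b = b} {t} comp y∈ in
    Equivalence.from (enum₂ _) (inZ , Equivalence.from (side⇔ _) asc , last)
  inequality : ClassInequality xCandidates zCandidates k
  inequality = classInequality (L₁⊆class (here refl))

proposition4p5 : (μ : List ℕ) → IsComposition 10 μ → (t : ℕ) → 1 ≤ t →
    ((L₁ L₂ : List Word) →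
      Enumerates L₁ (λ y → InX μ y × (y ! 8 < y ! 9) × (y ! 9 ≡ t)) →
      Enumerates L₂ (λ y → InZ μ y × (y ! 8 < y ! 9) × (y ! 9 ≡ t)) →
      Σℚ (map lhsTerm L₁) ℚ.≤ Σℚ (map rhsTerm L₂))
    ×
    ((L₁ L₂ : List Word) →
      Enumerates L₁ (λ y → InX μ y × (y ! 8 ≥ y ! 9) × (y ! 9 ≡ t)) →
      Enumerates L₂ (λ y → InZ μ y × (y ! 8 ≥ y ! 9) × (y ! 9 ≡ t)) →
      Σℚ (map lhsTerm L₁) ℚ.≤ Σℚ (map rhsTerm L₂))
proposition4p5 μ comp t _ =
  classBound comp (λ y → y ! 8 < y ! 9) true ascent≡true⇔ t ,
  classBound comp (λ y → y ! 8 ≥ y ! 9) false ascent≡false⇔ t
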